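{- There exists a uniform morphism $\varphi:\{0,1\}^*\to\{0,1\}^*$ having two infinite fixed points such that one of them is weak abelian periodic and the other is not.
   Context: A morphism $\varphi$ on $\{0,1\}^*$ is uniform if $|\varphi(0)|=|\varphi(1)|$. An infinite fixed point of $\varphi$ is an infinite word $w$ with $\varphi(w)=w$. For a nonempty finite word $u$, $\rho_a(u)=|u|_a/|u|$, where $|u|_a$ is the number of occurrences of the letter $a$. An infinite word $w$ over a finite alphabet $\Sigma$ is weak abelian periodic if $w=v_0v_1v_2\cdots$ with finite words $v_i$ ($v_i$ nonempty for $i\ge1$) such that $\rho_a(v_i)=\rho_a(v_j)$ for all $a\in\Sigma$ and all $i,j\ge1$. -}

module Defs where

open import Data.Bool using (Bool; true; false; if_then_else_)
open import Data.Nat using (ℕ; zero; suc; _+_; _*_; _∸_; _≤_; _<_)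
open import Data.List using (List; []; _∷_; length; _++_)
open import Data.Product using (Σ; ∃; _×_; _,_)
open import Relation.Binary.PropositionalEquality using (_≡_)

-- Alphabet {0,1} is represented by Bool (false = 0, true = 1).
-- Finite words: List Bool.  Infinite words: ℕ → Bool.
InfWord : Set
InfWord = ℕ → Bool

Morphism : Set
Morphism = Bool → List Bool

apply : Morphism → List Bool → List Bool
apply φ []       = []
apply φ (a ∷ u)  = φ a ++ apply φ u

Uniform : Morphism → Set
Uniform φ = length (φ false) ≡ length (φ true)

factor : InfWord → ℕ → ℕ → List Bool
factor w m zero    = []
factor w m (suc n) = w m ∷ factor w (suc m) n

prefix : InfWord → ℕ → List Bool
prefix w n = factor w 0 n

IsPrefixOf : List Bool → InfWord → Set
IsPrefixOf u w = u ≡ prefix w (length u)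

-- φ(w) = w for an infinite word w: φ(w) is the limit of φ(w[0,n));
-- it equals w iff every φ(w[0,n)) is a prefix of w and these images are
-- unboundedly long (so that φ(w) is infinite).
IsFixedPoint : Morphism → InfWord → Set
IsFixedPoint φ w =
  (∀ n → IsPrefixOf (apply φ (prefix w n)) w) ×
  (∀ m → ∃ λ n → m ≤ length (apply φ (prefix w n)))

count : Bool → List Bool → ℕ
count a [] = 0
count a (b ∷ u) with a | b
... | true  | true  = suc (count a u)
... | false | false = suc (count a u)
... | _     | _     = count a u

-- ρ_a(u) = ρ_a(v) for nonempty u, v, stated by cross-multiplication:
-- |u|_a / |u| = |v|_a / |v|  ⇔  |u|_a * |v| = |v|_a * |u|.
SameFreq : Bool → List Bool → List Bool → Set
SameFreq a u v = count a u * length v ≡ count a v * length u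

-- A decomposition w = v₀ v₁ v₂ ⋯ is given by
-- cut points p 0 < p 1 < p 2 < ⋯ with v₀ = w[0, p 0) (possibly empty) and
-- v_{i+1} = w[p i, p (i+1)) (nonempty, by strictness).
block : InfWord → (ℕ → ℕ) → ℕ → List Bool
block w p i = factor w (p i) (p (suc i) ∸ p i)

WeakAbelianPeriodic : InfWord → Set
WeakAbelianPeriodic w =
  Σ (ℕ → ℕ) λ p →
    (∀ i → p i < p (suc i)) ×
    (∀ (a : Bool) (i j : ℕ) → SameFreq a (block w p i) (block w p j))

-- Structure.  (1) A word w with φ(w m) = w[km, km+k) for all m (k ≥ 1) is
-- a fixed point of φ; both 0^ω and w₂ are of this form.  w₂ is defined
-- directly: w₂ i = 1 iff no ternary digit of i is 2.  (2) The number
-- ones M of 1s in w₂[0, M) satisfies ones (3M) = 2·ones M, hence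
-- ones (3^k) = 2^k, and so the 1s of w₂ have density tending to 0:
-- for all A, B eventually A + B·ones M < M.  (3) In any weak abelian
-- periodic decomposition w = v₀v₁v₂⋯, the word v₁⋯vₙ has the same letter
-- frequencies as v₁, so the count of 1s in w[0, |v₀⋯vₙ|) grows linearly.
-- If v₁ contains a 1 this contradicts the vanishing density of (2); if
-- it contains none, the count stays bounded, contradicting ones (3^k) = 2^k.
module Submission where

open import Defs
open import Data.Product using (Σ; _×_; _,_; ∃)
open import Relation.Nullary using (¬_; yes; no; contradiction)
open import Data.Bool using (Bool; true; false)
open import Data.Nat
open import Data.Nat.Properties
open import Data.List using (List; []; _∷_; length; _++_)
open import Data.List.Properties using (length-++; ++-assoc; ++-identityʳ)
open import Data.Empty using (⊥)
open import Relation.Binary.PropositionalEquality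
  using (_≡_; refl; sym; trans; cong; cong₂; subst; subst₂; module ≡-Reasoning)
open import Data.Nat.Tactic.RingSolver using (solve-∀)

length-factor : ∀ w m n → length (factor w m n) ≡ n
length-factor w m zero    = refl
length-factor w m (suc n) = cong suc (length-factor w (suc m) n)

factor-++ : ∀ w m a b → factor w m (a + b) ≡ factor w m a ++ factor w (m + a) b
factor-++ w m zero    b = cong (λ i → factor w i b) (sym (+-identityʳ m))
factor-++ w m (suc a) b =
  cong (w m ∷_) (trans (factor-++ w (suc m) a b) (cong (λ i → factor w (suc m) a ++ factor w i b) (sym (+-suc m a))))

prefix-extend : ∀ w {m n} → m ≤ n → prefix w n ≡ prefix w m ++ factor w m (n ∸ m)
prefix-extend w {m} {n} m≤n =
  trans (cong (prefix w) (sym (m+[n∸m]≡n m≤n))) (factor-++ w 0 m (n ∸ m))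

SelfSimilar : Morphism → ℕ → InfWord → Set
SelfSimilar φ k w = ∀ m → φ (w m) ≡ factor w (m * k) k

apply-factor : ∀ φ k w → SelfSimilar φ k w →
               ∀ m n → apply φ (factor w m n) ≡ factor w (m * k) (n * k)
apply-factor φ k w self m zero    = refl
apply-factor φ k w self m (suc n) = begin
    φ (w m) ++ apply φ (factor w (suc m) n)
  ≡⟨ cong₂ _++_ (self m) (apply-factor φ k w self (suc m) n) ⟩
    factor w (m * k) k ++ factor w (k + m * k) (n * k)
  ≡⟨ cong (λ i → factor w (m * k) k ++ factor w i (n * k)) (+-comm k (m * k)) ⟩
    factor w (m * k) k ++ factor w (m * k + k) (n * k)
  ≡⟨ sym (factor-++ w (m * k) k (n * k)) ⟩
    factor w (m * k) (k + n * k)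
  ∎
  where open ≡-Reasoning

selfSimilar⇒fixedPoint : ∀ φ k .{{_ : NonZero k}} w → SelfSimilar φ k w → IsFixedPoint φ w
selfSimilar⇒fixedPoint φ k w self = isPrefix , unbounded
  where
  image : ∀ n → apply φ (prefix w n) ≡ prefix w (n * k)
  image = apply-factor φ k w self 0

  image-length : ∀ n → length (apply φ (prefix w n)) ≡ n * k
  image-length n = trans (cong length (image n)) (length-factor w 0 (n * k))

  isPrefix : ∀ n → IsPrefixOf (apply φ (prefix w n)) w
  isPrefix n = trans (image n) (cong (prefix w) (sym (image-length n)))

  unbounded : ∀ m → ∃ λ n → m ≤ length (apply φ (prefix w n))
  unbounded m = m , subst (m ≤_) (sym (image-length m)) (m≤m*n m k)

-- the morphism of Proposition 5; it is 3-uniform, and φ(0) = 000, φ(1) = 110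
-- begin with 0 and 1, so each letter seeds an infinite fixed point
φ : Morphism
φ true  = true ∷ true ∷ false ∷ []
φ false = false ∷ false ∷ false ∷ []

-- letter r b is the letter at position r < 3 of φ(b)
letter : ℕ → Bool → Bool
letter 2 _ = false
letter _ b = b

φ-letters : ∀ b → φ b ≡ letter 0 b ∷ letter 1 b ∷ letter 2 b ∷ []
φ-letters true  = refl
φ-letters false = refl

w₁ : InfWord
w₁ _ = false

div3 : ℕ → ℕ
div3 (suc (suc (suc n))) = suc (div3 n)
div3 _                   = 0

mod3 : ℕ → ℕ
mod3 (suc (suc (suc n))) = mod3 n
mod3 n                   = n

div3-mod3 : ∀ m r → r < 3 → div3 (m * 3 + r) ≡ m × mod3 (m * 3 + r) ≡ r
div3-mod3 zero    0 _ = refl , refl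
div3-mod3 zero    1 _ = refl , refl
div3-mod3 zero    2 _ = refl , refl
div3-mod3 zero    (suc (suc (suc _))) (s≤s (s≤s (s≤s ())))
div3-mod3 (suc m) r r<3 with div3-mod3 m r r<3
... | q≡m , r≡r = cong suc q≡m , r≡r

-- bounds used to show that fuel i suffices for position i
div3≤ : ∀ n → div3 n ≤ n
div3≤ 0 = z≤n
div3≤ 1 = z≤n
div3≤ 2 = z≤n
div3≤ (suc (suc (suc n))) = s≤s (≤-trans (div3≤ n) (≤-trans (n≤1+n n) (n≤1+n (suc n))))

div3-< : ∀ {i f} → i ≤ suc f → div3 i ≤ f
div3-< {zero}              _           = z≤n
div3-< {suc zero}          _           = z≤n
div3-< {suc (suc zero)}    _           = z≤n
div3-< {suc (suc (suc i))} (s≤s i+2≤f) = ≤-trans (s≤s (≤-trans (div3≤ i) (n≤1+n i))) i+2≤f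

-- noTwo f i = 1 iff the ternary digits of i contain no 2, reading at most
-- f digits; fuel f ≥ i suffices to read all of them.
noTwo : ℕ → ℕ → Bool
noTwo zero    _ = true
noTwo (suc f) i = letter (mod3 i) (noTwo f (div3 i))

noTwo-zero : ∀ f → noTwo f 0 ≡ true
noTwo-zero zero    = refl
noTwo-zero (suc f) = noTwo-zero f

noTwo-fuel : ∀ f g i → i ≤ f → i ≤ g → noTwo f i ≡ noTwo g i
noTwo-fuel zero    g       zero z≤n _   = sym (noTwo-zero g)
noTwo-fuel (suc f) zero    zero _   z≤n = noTwo-zero (suc f)
noTwo-fuel (suc f) (suc g) i    i≤f i≤g =
  cong (letter (mod3 i)) (noTwo-fuel f g (div3 i) (div3-< i≤f) (div3-< i≤g))

w₂ : InfWord
w₂ i = noTwo i i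

w₂-rec : ∀ i → w₂ i ≡ letter (mod3 i) (w₂ (div3 i))
w₂-rec i = trans (noTwo-fuel i (suc i) i ≤-refl (n≤1+n i))
  (cong (letter (mod3 i)) (noTwo-fuel i (div3 i) (div3 i) (div3≤ i) ≤-refl))

w₂-digit : ∀ m r → r < 3 → w₂ (r + m * 3) ≡ letter r (w₂ m)
w₂-digit m r r<3 with div3-mod3 m r r<3
... | q≡m , r≡r = begin
    w₂ (r + m * 3)
  ≡⟨ cong w₂ (+-comm r (m * 3)) ⟩
    w₂ (m * 3 + r)
  ≡⟨ w₂-rec (m * 3 + r) ⟩
    letter (mod3 (m * 3 + r)) (w₂ (div3 (m * 3 + r)))
  ≡⟨ cong₂ letter r≡r (cong w₂ q≡m) ⟩
    letter r (w₂ m)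
  ∎
  where open ≡-Reasoning

w₂-selfSimilar : SelfSimilar φ 3 w₂
w₂-selfSimilar m = trans (φ-letters (w₂ m)) (sym
  (cong₂ _∷_ (w₂-digit m 0 (s≤s z≤n))
  (cong₂ _∷_ (w₂-digit m 1 (s≤s (s≤s z≤n)))
  (cong₂ _∷_ (w₂-digit m 2 (s≤s (s≤s (s≤s z≤n)))) refl))))

count-++ : ∀ a u v → count a (u ++ v) ≡ count a u + count a v
count-++ a     []          v = refl
count-++ true  (true ∷ u)  v = cong suc (count-++ true u v)
count-++ true  (false ∷ u) v = count-++ true u v
count-++ false (true ∷ u)  v = count-++ false u v
count-++ false (false ∷ u) v = cong suc (count-++ false u v)

count≤length : ∀ a u → count a u ≤ length u
count≤length a     []          = z≤n
count≤length true  (true ∷ u)  = s≤s (count≤length true u)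
count≤length true  (false ∷ u) = m≤n⇒m≤1+n (count≤length true u)
count≤length false (true ∷ u)  = m≤n⇒m≤1+n (count≤length false u)
count≤length false (false ∷ u) = s≤s (count≤length false u)

count-prefix-mono : ∀ a w {m n} → m ≤ n → count a (prefix w m) ≤ count a (prefix w n)
count-prefix-mono a w {m} {n} m≤n = subst (count a (prefix w m) ≤_)
  (sym (trans (cong (count a) (prefix-extend w m≤n)) (count-++ a (prefix w m) _)))
  (m≤m+n (count a (prefix w m)) _)

count-apply-φ : ∀ u → count true (apply φ u) ≡ 2 * count true u
count-apply-φ []          = refl
count-apply-φ (false ∷ u) = count-apply-φ u
count-apply-φ (true ∷ u)  = begin
    suc (suc (count true (apply φ u)))
  ≡⟨ cong (2 +_) (count-apply-φ u) ⟩
    2 + 2 * count true u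
  ≡⟨ *-distribˡ-+ 2 1 (count true u) ⟨
    2 * suc (count true u)
  ∎
  where open ≡-Reasoning

ones : ℕ → ℕ
ones M = count true (prefix w₂ M)

ones≤ : ∀ M → ones M ≤ M
ones≤ M = subst (ones M ≤_) (length-factor w₂ 0 M) (count≤length true (prefix w₂ M))

-- w₂[0, 3M) = φ(w₂[0, M)) has twice as many 1s, so ones (3^k) = 2^k
ones-3^ : ∀ k → ones (3 ^ k) ≡ 2 ^ k
ones-3^ zero    = refl
ones-3^ (suc k) = begin
    ones (3 * 3 ^ k)
  ≡⟨ cong ones (*-comm 3 (3 ^ k)) ⟩
    count true (prefix w₂ (3 ^ k * 3))
  ≡⟨ cong (count true) (apply-factor φ 3 w₂ w₂-selfSimilar 0 (3 ^ k)) ⟨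
    count true (apply φ (prefix w₂ (3 ^ k)))
  ≡⟨ count-apply-φ (prefix w₂ (3 ^ k)) ⟩
    2 * ones (3 ^ k)
  ≡⟨ cong (2 *_) (ones-3^ k) ⟩
    2 * 2 ^ k
  ∎
  where open ≡-Reasoning

n<2^n : ∀ n → n < 2 ^ n
n<2^n zero    = s≤s z≤n
n<2^n (suc n) = begin-strict
    suc n          <⟨ s≤s (n<2^n n) ⟩
    suc (2 ^ n)    ≤⟨ +-monoˡ-≤ (2 ^ n) (m^n>0 2 n) ⟩
    2 ^ n + 2 ^ n  ≡⟨ cong (2 ^ n +_) (+-identityʳ (2 ^ n)) ⟨
    2 ^ suc n      ∎
  where open ≤-Reasoning

2^j*j≤2*3^j : ∀ j → 2 ^ j * j ≤ 2 * 3 ^ j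
2^j*j≤2*3^j zero    = z≤n
2^j*j≤2*3^j (suc j) = begin
    2 * 2 ^ j * suc j              ≡⟨ expand (2 ^ j) j ⟩
    2 * (2 ^ j * j) + 2 * 2 ^ j    ≤⟨ +-mono-≤ (*-monoʳ-≤ 2 (2^j*j≤2*3^j j))
                                               (*-monoʳ-≤ 2 (^-monoˡ-≤ j (s≤s (s≤s z≤n)))) ⟩
    2 * (2 * 3 ^ j) + 2 * 3 ^ j    ≡⟨ collect (3 ^ j) ⟩
    2 * (3 * 3 ^ j)                ∎
  where
  open ≤-Reasoning
  expand : ∀ x y → 2 * x * suc y ≡ 2 * (x * y) + 2 * x
  expand = solve-∀
  collect : ∀ x → 2 * (2 * x) + 2 * x ≡ 2 * (3 * x)
  collect = solve-∀

2^j*Q≤3^j : ∀ Q j → 2 * Q ≤ j → 2 ^ j * Q ≤ 3 ^ j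
2^j*Q≤3^j Q j 2Q≤j = *-cancelˡ-≤ 2 (begin
    2 * (2 ^ j * Q)  ≡⟨ *-comm-middle (2 ^ j) Q ⟩
    2 ^ j * (2 * Q)  ≤⟨ *-monoʳ-≤ (2 ^ j) 2Q≤j ⟩
    2 ^ j * j        ≤⟨ 2^j*j≤2*3^j j ⟩
    2 * 3 ^ j        ∎)
  where
  open ≤-Reasoning
  *-comm-middle : ∀ x q → 2 * (x * q) ≡ x * (2 * q)
  *-comm-middle = solve-∀

ternary-scale : ∀ M → 1 ≤ M → ∃ λ j → M ≤ 3 ^ j × 3 ^ j < 3 * M
ternary-scale M 1≤M = search M (<⇒≤ (≤-trans (n<2^n M) (^-monoˡ-≤ M (s≤s (s≤s z≤n)))))
  where
  search : ∀ k → M ≤ 3 ^ k → ∃ λ j → M ≤ 3 ^ j × 3 ^ j < 3 * M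
  search zero    M≤1 = 0 , M≤1 , ≤-trans (s≤s (s≤s z≤n)) (*-monoʳ-≤ 3 1≤M)
  search (suc k) M≤3^k+1 with 3 ^ suc k <? 3 * M
  ... | yes 3^k+1<3M = suc k , M≤3^k+1 , 3^k+1<3M
  ... | no  3^k+1≮3M = search k (*-cancelˡ-≤ 3 (≮⇒≥ 3^k+1≮3M))

ones-sparse : ∀ A B → ∃ λ N → ∀ M → N ≤ M → A + B * ones M < M
ones-sparse A B = 3 ^ J , eventually
  where
  Q J : ℕ
  Q = 3 * (A + B)
  J = 2 * Q

  eventually : ∀ M → 3 ^ J ≤ M → A + B * ones M < M
  eventually M 3^J≤M with ternary-scale M (≤-trans (m^n>0 3 J) 3^J≤M)
  ... | j , M≤3^j , 3^j<3M = *-cancelˡ-< 3 _ _ (begin-strict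
      3 * (A + B * ones M)   ≤⟨ *-monoʳ-≤ 3 (+-monoʳ-≤ A (*-monoʳ-≤ B ones-M≤2^j)) ⟩
      3 * (A + B * 2 ^ j)    ≤⟨ *-monoʳ-≤ 3 (+-monoˡ-≤ (B * 2 ^ j) (m≤n*m A (2 ^ j) {{m^n≢0 2 j}})) ⟩
      3 * (2 ^ j * A + B * 2 ^ j)  ≡⟨ factorise (2 ^ j) A B ⟩
      2 ^ j * Q              ≤⟨ 2^j*Q≤3^j Q j J≤j ⟩
      3 ^ j                  <⟨ 3^j<3M ⟩
      3 * M                  ∎)
    where
    open ≤-Reasoning
    factorise : ∀ x a b → 3 * (x * a + b * x) ≡ x * (3 * (a + b))
    factorise = solve-∀
    ones-M≤2^j : ones M ≤ 2 ^ j
    ones-M≤2^j = subst (ones M ≤_) (ones-3^ j) (count-prefix-mono true w₂ M≤3^j)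
    J≤j : J ≤ j
    J≤j with J ≤? j
    ... | yes J≤j = J≤j
    ... | no  J≰j = contradiction (≤-trans 3^J≤M M≤3^j) (<⇒≱ (^-monoʳ-< 3 (s≤s (s≤s z≤n)) (≰⇒> J≰j)))

-- constant words are weak abelian periodic: cut after every letter
constant-WAP : ∀ b → WeakAbelianPeriodic (λ _ → b)
constant-WAP b = (λ i → i) , n<1+n , λ a i j → subst₂ (SameFreq a) (sym (single i)) (sym (single j)) refl
  where
  single : ∀ i → block (λ _ → b) (λ i → i) i ≡ b ∷ []
  single i = cong (factor (λ _ → b) i) (m+n∸n≡m 1 i)

SameFreq-++ : ∀ a u v x → SameFreq a u x → SameFreq a v x → SameFreq a (u ++ v) x
SameFreq-++ a u v x u~x v~x = begin
    count a (u ++ v) * length x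
  ≡⟨ cong (_* length x) (count-++ a u v) ⟩
    (count a u + count a v) * length x
  ≡⟨ *-distribʳ-+ (length x) (count a u) (count a v) ⟩
    count a u * length x + count a v * length x
  ≡⟨ cong₂ _+_ u~x v~x ⟩
    count a x * length u + count a x * length v
  ≡⟨ *-distribˡ-+ (count a x) (length u) (length v) ⟨
    count a x * (length u + length v)
  ≡⟨ cong (count a x *_) (length-++ u) ⟨
    count a x * length (u ++ v)
  ∎
  where open ≡-Reasoning

-- blocks w p n = v₁ ⋯ vₙ, the first n nonempty blocks of the decomposition
blocks : InfWord → (ℕ → ℕ) → ℕ → List Bool
blocks w p zero    = []
blocks w p (suc n) = blocks w p n ++ block w p n

blocks-SameFreq : ∀ a w p → (∀ n → SameFreq a (block w p n) (block w p 0)) →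
                  ∀ n → SameFreq a (blocks w p n) (block w p 0)
blocks-SameFreq a w p same zero    = sym (*-zeroʳ (count a (block w p 0)))
blocks-SameFreq a w p same (suc n) =
  SameFreq-++ a (blocks w p n) (block w p n) (block w p 0) (blocks-SameFreq a w p same n) (same n)

prefix-blocks : ∀ w p → (∀ i → p i ≤ p (suc i)) → ∀ n → prefix w (p n) ≡ prefix w (p 0) ++ blocks w p n
prefix-blocks w p monotone zero    = sym (++-identityʳ (prefix w (p 0)))
prefix-blocks w p monotone (suc n) = begin
    prefix w (p (suc n))
  ≡⟨ prefix-extend w (monotone n) ⟩
    prefix w (p n) ++ block w p n
  ≡⟨ cong (_++ block w p n) (prefix-blocks w p monotone n) ⟩
    (prefix w (p 0) ++ blocks w p n) ++ block w p n
  ≡⟨ ++-assoc (prefix w (p 0)) (blocks w p n) (block w p n) ⟩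
    prefix w (p 0) ++ blocks w p (suc n)
  ∎
  where open ≡-Reasoning

n≤increasing : ∀ (p : ℕ → ℕ) → (∀ i → p i < p (suc i)) → ∀ n → n ≤ p n
n≤increasing p increasing zero    = z≤n
n≤increasing p increasing (suc n) = ≤-trans (s≤s (n≤increasing p increasing n)) (increasing n)

module Decomposition (p : ℕ → ℕ) (increasing : ∀ i → p i < p (suc i))
                     (sameFreq : ∀ n → SameFreq true (block w₂ p n) (block w₂ p 0)) where

  v₁ : List Bool
  v₁ = block w₂ p 0

  L : ℕ
  L = length v₁

  L>0 : L > 0
  L>0 = subst (_> 0) (sym (length-factor w₂ (p 0) (p 1 ∸ p 0))) (m<n⇒0<n∸m (increasing 0))

  prefix-at-cut : ∀ n → prefix w₂ (p n) ≡ prefix w₂ (p 0) ++ blocks w₂ p n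
  prefix-at-cut = prefix-blocks w₂ p (λ i → <⇒≤ (increasing i))

  ones-at-cut : ∀ n → ones (p n) ≡ ones (p 0) + count true (blocks w₂ p n)
  ones-at-cut n = trans (cong (count true) (prefix-at-cut n)) (count-++ true (prefix w₂ (p 0)) (blocks w₂ p n))

  cut-length : ∀ n → p n ≡ p 0 + length (blocks w₂ p n)
  cut-length n = begin
      p n                                             ≡⟨ length-factor w₂ 0 (p n) ⟨
      length (prefix w₂ (p n))                        ≡⟨ cong length (prefix-at-cut n) ⟩
      length (prefix w₂ (p 0) ++ blocks w₂ p n)       ≡⟨ length-++ (prefix w₂ (p 0)) ⟩
      length (prefix w₂ (p 0)) + length (blocks w₂ p n) ≡⟨ cong (_+ length (blocks w₂ p n)) (length-factor w₂ 0 (p 0)) ⟩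
      p 0 + length (blocks w₂ p n)                    ∎
    where open ≡-Reasoning

  frequency : ∀ n → count true (blocks w₂ p n) * L ≡ count true v₁ * length (blocks w₂ p n)
  frequency = blocks-SameFreq true w₂ p sameFreq

  -- If v₁ has no 1, then no block has, and the number of 1s stops growing
  -- after p₀; but ones (3^k) = 2^k is unbounded.
  no-1-free-blocks : count true v₁ ≡ 0 → ⊥
  no-1-free-blocks c≡0 = <⇒≱ (≤-<-trans (ones≤ P) (n<2^n P)) 2^P≤ones-P
    where
    P n : ℕ
    P = p 0
    n = 3 ^ P
    no-1s : count true (blocks w₂ p n) ≡ 0
    no-1s = m*n≡0⇒m≡0 _ L {{>-nonZero L>0}} (trans (frequency n) (cong (_* length (blocks w₂ p n)) c≡0))
    2^P≤ones-P : 2 ^ P ≤ ones P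
    2^P≤ones-P = begin
        2 ^ P                                   ≡⟨ ones-3^ P ⟨
        ones n                                  ≤⟨ count-prefix-mono true w₂ (n≤increasing p increasing n) ⟩
        ones (p n)                              ≡⟨ ones-at-cut n ⟩
        ones P + count true (blocks w₂ p n)     ≡⟨ cong (ones P +_) no-1s ⟩
        ones P + 0                              ≡⟨ +-identityʳ (ones P) ⟩
        ones P                                  ∎
      where open ≤-Reasoning

  -- If v₁ has a 1, then pₙ ≤ p₀ + L·ones pₙ, so the 1s of w₂ keep a
  -- positive density along the cuts, contradicting their sparseness.
  no-1-dense-blocks : count true v₁ > 0 → ⊥
  no-1-dense-blocks c>0 with ones-sparse (p 0) L
  ... | N , sparse = <⇒≱ (sparse (p N) (n≤increasing p increasing N)) dense
    where
    B : List Bool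
    B = blocks w₂ p N
    dense : p N ≤ p 0 + L * ones (p N)
    dense = begin
        p N                                     ≡⟨ cut-length N ⟩
        p 0 + length B                          ≤⟨ +-monoʳ-≤ (p 0) (m≤n*m (length B) (count true v₁) {{>-nonZero c>0}}) ⟩
        p 0 + count true v₁ * length B          ≡⟨ cong (p 0 +_) (frequency N) ⟨
        p 0 + count true B * L                  ≤⟨ +-monoʳ-≤ (p 0) (*-monoˡ-≤ L (m≤n+m (count true B) (ones (p 0)))) ⟩
        p 0 + (ones (p 0) + count true B) * L   ≡⟨ cong (λ t → p 0 + t * L) (ones-at-cut N) ⟨
        p 0 + ones (p N) * L                    ≡⟨ cong (p 0 +_) (*-comm (ones (p N)) L) ⟩
        p 0 + L * ones (p N)                    ∎
      where open ≤-Reasoning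

w₂-not-WAP : ¬ WeakAbelianPeriodic w₂
w₂-not-WAP (p , increasing , sameFreq) with count true (block w₂ p 0) ≟ 0
... | yes c≡0 = Decomposition.no-1-free-blocks p increasing (λ n → sameFreq true n 0) c≡0
... | no  c≢0 = Decomposition.no-1-dense-blocks p increasing (λ n → sameFreq true n 0) (n≢0⇒n>0 c≢0)

proposition5 : Σ Morphism λ φ → Uniform φ ×
                 Σ InfWord λ w₁ → Σ InfWord λ w₂ →
                   IsFixedPoint φ w₁ × IsFixedPoint φ w₂ ×
                   WeakAbelianPeriodic w₁ × ¬ WeakAbelianPeriodic w₂
proposition5 =
  φ , refl , w₁ , w₂ ,
  selfSimilar⇒fixedPoint φ 3 w₁ (λ m → refl) ,
  selfSimilar⇒fixedPoint φ 3 w₂ w₂-selfSimilar ,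
  constant-WAP false ,
  w₂-not-WAP
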